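{- Let $m,n\ge 1$, let $G=G_{m\times n}$, let $d=\gcd(m+1,n+1)$ and let $u=(a,b)$ be a vertex of $G$. If $d\mid a$ or $d\mid b$, then there is a closed 90-degree trail at $u$. Furthermore, such a trail can be obtained from a ray going from $u$ in the direction $(+1,+1)$ or in the direction $(-1,-1)$.
   Context: $G_{m\times n}=P_m\square P_n$ is the grid graph with vertex set $[m]\times[n]$, $(i,j)\sim(i',j')$ iff $|i-i'|+|j-j'|=1$, embedded in the rectangle $R=[0,m+1]\times[0,n+1]$. A ray from a vertex $v$ leaves $v$ in one of the four diagonal directions $(\pm1,\pm1)$ and travels in a straight line, reflecting off the sides of $R$ in the usual manner (on hitting a vertical side the $x$-component of the direction flips, on hitting a horizontal side the $y$-component flips); it stops when it hits one of the four corners of $R$ or when it returns to $v$. A trail at $v$ is the collection of straight line segments (between $v$ and points on the boundary of $R$, and between boundary points) traced either by a single ray from $v$ or by two rays from $v$ in different directions. Only trails having exactly two straight line segments touching $v$ are considered; such a trail is a 90-degree trail or a 180-degree trail according to the angle between these two segments at $v$. A trail is open if both of its ends go to corners of $R$, and closed otherwise. -}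

module Defs where

open import Data.Nat using (ℕ; zero; suc; _+_; _∸_; _≤_; _<_; _≡ᵇ_)
open import Data.Bool using (Bool; true; false; if_then_else_)
open import Data.Product using (_×_; _,_; Σ; proj₁; proj₂)
open import Data.Sum using (_⊎_)
open import Relation.Binary.PropositionalEquality using (_≡_; _≢_)
open import Relation.Nullary using (¬_)

-- Discretisation of a ray in R = [0,m+1] × [0,n+1].
-- A diagonal ray starting at a lattice point is at a lattice point at
-- every integer time, and it meets the boundary of R only at integer
-- times, so it is described exactly by its states at integer times.
-- A direction component is a Bool: true = +1, false = -1.

record RayState : Set where
  constructor st
  field
    px : ℕ
    py : ℕ
    dx : Bool
    dy : Bool
open RayState public

move : Bool → ℕ → ℕ
move true  x = suc x
move false x = x ∸ 1

reflect : ℕ → ℕ → Bool → Bool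
reflect L x d =
  if x ≡ᵇ 0 then true else (if x ≡ᵇ L then false else d)

step : ℕ → ℕ → RayState → RayState
step m n (st x y ddx ddy) =
  let x' = move ddx x
      y' = move ddy y
  in st x' y' (reflect (suc m) x' ddx) (reflect (suc n) y' ddy)

rayAt : ℕ → ℕ → RayState → ℕ → RayState
rayAt m n s zero    = s
rayAt m n s (suc t) = step m n (rayAt m n s t)

IsCorner : ℕ → ℕ → ℕ → ℕ → Set
IsCorner m n x y = (x ≡ 0 ⊎ x ≡ suc m) × (y ≡ 0 ⊎ y ≡ suc n)

IsVertex : ℕ → ℕ → ℕ → ℕ → Set
IsVertex m n a b = (1 ≤ a × a ≤ m) × (1 ≤ b × b ≤ n)

-- Since (a,b) is interior, no reflection happens at the
-- return, so the direction stored at time t is the arrival direction.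
ReturnsAt : ℕ → ℕ → ℕ → ℕ → Bool → Bool → ℕ → Set
ReturnsAt m n a b ex ey t =
  let s = rayAt m n (st a b ex ey) in
  (1 ≤ t) ×
  (px (s t) ≡ a × py (s t) ≡ b) ×
  ((k : ℕ) → 1 ≤ k → k < t →
     ¬ IsCorner m n (px (s k)) (py (s k)) × ¬ (px (s k) ≡ a × py (s k) ≡ b))

-- The single ray from (a,b) in direction (ex,ey) forms a closed
-- 90-degree trail at (a,b): it returns to (a,b) (so the trail is closed,
-- not ending in corners), and the two segments touching (a,b) -- the
-- outgoing one in direction (ex,ey) and the incoming one, which leaves
-- (a,b) in direction -(arrival direction) -- are at 90 degrees, i.e. the
-- arrival direction is perpendicular to (ex,ey).  For diagonal directions
-- (ex,ey)·(fx,fy) = 0 iff exactly one component differs.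
Perp : Bool → Bool → Bool → Bool → Set
Perp ex ey fx fy = (ex ≡ fx × ey ≢ fy) ⊎ (ex ≢ fx × ey ≡ fy)

RayClosed90Trail : ℕ → ℕ → ℕ → ℕ → Bool → Bool → Set
RayClosed90Trail m n a b ex ey =
  Σ ℕ λ t → ReturnsAt m n a b ex ey t ×
    (let s = rayAt m n (st a b ex ey) t in Perp ex ey (dx s) (dy s))

{-# OPTIONS --safe #-}
module Submission where

-- Unfolding the reflections, each coordinate of the ray from (a, b) in
-- direction (e, e) at time t is the image of A + t (A = ±a) under the
-- triangle wave folding ℤ onto [0, m+1], so being at a wall, or back at a with
-- kept or reversed direction, are congruences on t.  Let t range over ℤ,
-- negative times describing the ray in direction (-e, -e), and call t a turn
-- when one coordinate is back with its direction kept and the other with its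
-- direction reversed.  The turns are invariant under τ ↦ τ - p for every
-- common period p and under τ ↦ p - τ whenever both coordinates are reversed
-- at p, as happens at p = 2c for every corner time c.  A corner or a return
-- strictly between 0 and a turn thus yields a turn nearer to 0, so the ray
-- towards a turn of least absolute value closes a 90-degree trail.  If
-- gcd(m+1, n+1) divides a, Bézout gives a multiple of n+1 at which the first
-- coordinate is at a wall, and twice that time is a turn.

open import Defs
open import Data.Bool using (Bool; true; false; not; T)
open import Data.Bool.Properties using (not-¬)
open import Data.Integer using (ℤ; +_; -[1+_]; _+_; _-_; -_; _*_; ∣_∣; 0ℤ; 1ℤ)
import Data.Integer.Properties as ℤ
open import Data.Integer.Divisibility.Signed
  using (_∣_; divides; ∣-refl; _∣?_; ∣m∣n⇒∣m+n; ∣m∣n⇒∣m-n; ∣m⇒∣-m; ∣m+n∣n⇒∣m; ∣⇒∣ᵤ)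
open import Data.Integer.Tactic.RingSolver using (solve-∀)
open import Data.Nat using (ℕ; zero; suc; _≤_; _<_; _≡ᵇ_; z≤n; s≤s; z<s; NonZero)
import Data.Nat as ℕ
import Data.Nat.Properties as ℕ
open import Data.Nat.Divisibility using () renaming (_∣_ to _∣ℕ_; divides to dividesℕ; >⇒∤ to >⇒∤ℕ)
open import Data.Nat.GCD using (gcd; gcd-GCD; gcd-comm; module Bézout)
open import Data.Nat.Induction using (<-wellFounded)
open import Data.Product using (Σ; ∃; ∃₂; _×_; _,_; proj₁; proj₂)
open import Data.Sum using (_⊎_; inj₁; inj₂)
open import Data.Unit using (tt)
open import Induction.WellFounded using (Acc; acc)
open import Level using (0ℓ)
open import Relation.Binary.PropositionalEquality
open import Relation.Nullary using (¬_; Dec; yes; no; contradiction)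
open import Relation.Nullary.Decidable using (_×-dec_; _⊎-dec_)
open import Relation.Unary using (Pred; Decidable)

variable
  K L M N m n a b t u v x y : ℕ
  d e : Bool
  i z A B p τ : ℤ

minimal-witness : {P : Pred ℕ 0ℓ} → Decidable P → P n → ∃ λ t → P t × (∀ {j} → j < t → ¬ P j)
minimal-witness {P = P} P? = search (<-wellFounded _)
  where
  search : Acc _<_ n → P n → ∃ λ t → P t × (∀ {j} → j < t → ¬ P j)
  search {n} (acc smaller) Pn with ℕ.anyUpTo? P? n
  ... | yes (j , j<n , Pj) = search (smaller j<n) Pj
  ... | no none            = n , Pn , λ j<n Pj → none (_ , j<n , Pj)

∣∧<⇒≡0 : K ∣ℕ x → x < K → x ≡ 0
∣∧<⇒≡0 {x = zero}  _   _   = refl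
∣∧<⇒≡0 {x = suc x} K∣x x<K = contradiction K∣x (>⇒∤ℕ x<K)

∣∧∣i∣<⇒≡0 : + K ∣ i → ∣ i ∣ < K → i ≡ 0ℤ
∣∧∣i∣<⇒≡0 K∣i ∣i∣<K = ℤ.∣i∣≡0⇒i≡0 (∣∧<⇒≡0 (∣⇒∣ᵤ K∣i) ∣i∣<K)

mod-injective : x < K → y < K → + K ∣ + x - + y → x ≡ y
mod-injective {x} {K} {y} x<K y<K K∣x-y =
  ℤ.+-injective (ℤ.i-j≡0⇒i≡j (+ x) (+ y) (∣∧∣i∣<⇒≡0 K∣x-y ∣x-y∣<K))
  where
  ∣x-y∣<K : ∣ + x - + y ∣ < K
  ∣x-y∣<K = subst (_< K) (cong ∣_∣ (sym (ℤ.m-n≡m⊖n x y)))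
              (ℕ.≤-<-trans (ℤ.∣m⊝n∣≤m⊔n x y) (ℕ.⊔-pres-<m x<K y<K))

∣m-n∣<o : .{{NonZero t}} → u < v ℕ.+ t → v < u ℕ.+ t → ∣ + u - + v ∣ < t
∣m-n∣<o {t} {u} {v} u<v+t v<u+t with ℕ.≤-total u v
... | inj₁ u≤v = subst (_< t) (sym (trans (cong ∣_∣ (ℤ.m-n≡m⊖n u v)) (ℤ.∣⊖∣-≤ u≤v)))
                   (ℕ.m<n+o⇒m∸n<o v u v<u+t)
... | inj₂ v≤u = subst (_< t) (sym (trans (cong ∣_∣ (ℤ.m-n≡m⊖n u v)) (trans (ℤ.∣m⊖n∣≡∣n⊖m∣ u v) (ℤ.∣⊖∣-≤ v≤u))))
                   (ℕ.m<n+o⇒m∸n<o u v u<v+t)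

∣-half : + (M ℕ.+ M) ∣ i → + M ∣ i
∣-half {M} (divides q eq) = divides (q * + 2) (trans eq (double q (+ M)))
  where
  double : ∀ (q m : ℤ) → q * (m + m) ≡ (q * + 2) * m
  double = solve-∀

pos-linear-≡ : ∀ g y N x M → g ℕ.+ y ℕ.* N ≡ x ℕ.* M → + g + + y * + N ≡ + x * + M
pos-linear-≡ g y N x M eq =
  trans (cong (_+_ (+ g)) (sym (ℤ.pos-* y N))) (trans (cong +_ eq) (ℤ.pos-* x M))

bézout : ∀ M N → ∃₂ λ u v → u * + M + v * + N ≡ + gcd M N
bézout M N with Bézout.identity (gcd-GCD M N)
... | Bézout.+- x y eq = + x , - + y , (begin
  + x * + M + - + y * + N               ≡⟨ cong (_+ - + y * + N) (pos-linear-≡ (gcd M N) y N x M eq) ⟨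
  + gcd M N + + y * + N + - + y * + N   ≡⟨ cancel (+ gcd M N) (+ y) (+ N) ⟩
  + gcd M N                             ∎)
  where
  open ≡-Reasoning
  cancel : ∀ (g y N : ℤ) → g + y * N + - y * N ≡ g
  cancel = solve-∀
... | Bézout.-+ x y eq = - + x , + y , (begin
  - + x * + M + + y * + N               ≡⟨ cong (_+_ (- + x * + M)) (pos-linear-≡ (gcd M N) x M y N eq) ⟨
  - + x * + M + (+ gcd M N + + x * + M) ≡⟨ cancel (+ gcd M N) (+ x) (+ M) ⟩
  + gcd M N                             ∎)
  where
  open ≡-Reasoning
  cancel : ∀ (g x M : ℤ) → - x * M + (g + x * M) ≡ g
  cancel = solve-∀

reflect-inside : 0 < x → x < L → reflect L x d ≡ d
reflect-inside {suc x} {L} _ x<L with suc x ≡ᵇ L in eq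
... | true  = contradiction (ℕ.≡ᵇ⇒≡ (suc x) L (subst T (sym eq) tt)) (ℕ.<⇒≢ x<L)
... | false = refl

reflect-top : 0 < L → reflect L L d ≡ false
reflect-top {suc l} _ with l ≡ᵇ l | ℕ.≡⇒≡ᵇ l l refl
... | true | _ = refl

-- Folding ℤ onto [0, M] by the reflections in 0 and M: z lands on x moving
-- up when z ≡ x and moving down when z ≡ -x (mod 2M); at a wall the
-- direction is already the reflected one.
data Folds (M : ℕ) (z : ℤ) : ℕ → Bool → Set where
  rising  : x < M → + (M ℕ.+ M) ∣ z - + x → Folds M z x true
  falling : 0 < x → x ≤ M → + (M ℕ.+ M) ∣ z + + x → Folds M z x false

folds-suc : Folds M z x d → Folds M (z + 1ℤ) (move d x) (reflect M (move d x) d)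
folds-suc {M} {z} (rising {x} x<M 2M∣) with ℕ.m≤n⇒m<n∨m≡n x<M
... | inj₁ 1+x<M rewrite reflect-inside {d = true} z<s 1+x<M =
  rising 1+x<M (subst (_ ∣_) (shift z (+ x)) 2M∣)
  where
  shift : ∀ (z x : ℤ) → z - x ≡ (z + 1ℤ) - (1ℤ + x)
  shift = solve-∀
... | inj₂ refl rewrite reflect-top {d = true} (z<s {n = x}) =
  falling z<s ℕ.≤-refl (subst (_ ∣_) (bounce z (+ x)) (∣m∣n⇒∣m+n 2M∣ ∣-refl))
  where
  bounce : ∀ (z x : ℤ) → (z - x) + ((1ℤ + x) + (1ℤ + x)) ≡ (z + 1ℤ) + (1ℤ + x)
  bounce = solve-∀
folds-suc {z = z} (falling {suc zero} _ 0<M 2M∣) =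
  rising 0<M (subst (_ ∣_) (bounce z) 2M∣)
  where
  bounce : ∀ (z : ℤ) → z + 1ℤ ≡ (z + 1ℤ) - 0ℤ
  bounce = solve-∀
folds-suc {z = z} (falling {suc (suc x)} _ 2+x≤M 2M∣) rewrite reflect-inside {d = false} (z<s {n = x}) 2+x≤M =
  falling z<s (ℕ.<⇒≤ 2+x≤M) (subst (_ ∣_) (shift z (+ x)) 2M∣)
  where
  shift : ∀ (z x : ℤ) → z + (1ℤ + (1ℤ + x)) ≡ (z + 1ℤ) + (1ℤ + x)
  shift = solve-∀

folds-neg : 0 < x → x < M → Folds M z x d → Folds M (- z) x (not d)
folds-neg {x} {z = z} 0<x x<M (rising _ 2M∣) =
  falling 0<x (ℕ.<⇒≤ x<M) (subst (_ ∣_) (negate z (+ x)) (∣m⇒∣-m 2M∣))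
  where
  negate : ∀ (z x : ℤ) → - (z - x) ≡ - z + x
  negate = solve-∀
folds-neg {x} {z = z} 0<x x<M (falling _ _ 2M∣) =
  rising x<M (subst (_ ∣_) (negate z (+ x)) (∣m⇒∣-m 2M∣))
  where
  negate : ∀ (z x : ℤ) → - (z + x) ≡ - z - x
  negate = solve-∀

rising-falling-exclusive : Folds M z x true → ¬ Folds M z y false
rising-falling-exclusive {M} {z} {x} {y} (rising x<M 2M∣z-x) (falling 0<y y≤M 2M∣z+y) =
  ℕ.<⇒≢ 0<y (sym (ℕ.m+n≡0⇒n≡0 x (ℤ.+-injective x+y≡0)))
  where
  sum : ∀ (z x y : ℤ) → (z + y) - (z - x) ≡ x + y
  sum = solve-∀
  x+y≡0 : + (x ℕ.+ y) ≡ 0ℤ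
  x+y≡0 = ∣∧∣i∣<⇒≡0 (subst (_ ∣_) (sum z (+ x) (+ y)) (∣m∣n⇒∣m-n 2M∣z+y 2M∣z-x)) (ℕ.+-mono-<-≤ x<M y≤M)

folds-functional : Folds M z x d → Folds M z y e → x ≡ y × d ≡ e
folds-functional {M} {z} {x} {y = y} (rising x<M 2M∣) (rising y<M 2M∣′) =
  mod-injective (ℕ.m≤n⇒m≤n+o M x<M) (ℕ.m≤n⇒m≤n+o M y<M)
    (subst (_ ∣_) (difference z (+ x) (+ y)) (∣m∣n⇒∣m-n 2M∣′ 2M∣)) , refl
  where
  difference : ∀ (z x y : ℤ) → (z - y) - (z - x) ≡ x - y
  difference = solve-∀
folds-functional {M} {z} {x} {y = y} (falling 0<x x≤M 2M∣) (falling _ y≤M 2M∣′) =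
  mod-injective (ℕ.≤-<-trans x≤M M<2M) (ℕ.≤-<-trans y≤M M<2M)
    (subst (_ ∣_) (difference z (+ x) (+ y)) (∣m∣n⇒∣m-n 2M∣ 2M∣′)) , refl
  where
  M<2M : M < M ℕ.+ M
  M<2M = ℕ.m<m+n M (ℕ.<-≤-trans 0<x x≤M)
  difference : ∀ (z x y : ℤ) → (z + x) - (z + y) ≡ x - y
  difference = solve-∀
folds-functional r@(rising _ _) f@(falling _ _ _) = contradiction f (rising-falling-exclusive r)
folds-functional f@(falling _ _ _) r@(rising _ _) = contradiction f (rising-falling-exclusive r)

-- For the coordinate with unfolded start A, at time τ: back at its start
-- with its initial direction, back at its start with the opposite direction,
-- at a wall.  Opaque, so that M and A can be inferred from these types.
opaque
  Repeats : ℕ → ℤ → Set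
  Repeats M τ = + (M ℕ.+ M) ∣ τ

  Reverses : ℕ → ℤ → ℤ → Set
  Reverses M A τ = + (M ℕ.+ M) ∣ A + A + τ

  AtWall : ℕ → ℤ → ℤ → Set
  AtWall M A τ = + M ∣ A + τ

opaque
  unfolding Repeats Reverses AtWall

  repeats? : ∀ M τ → Dec (Repeats M τ)
  repeats? M τ = _ ∣? τ

  reverses? : ∀ M A τ → Dec (Reverses M A τ)
  reverses? M A τ = _ ∣? _

  folds-shift : Folds M z x d → Repeats M τ → Folds M (z + τ) x d
  folds-shift {z = z} {x = x} {τ = τ} (rising x<M 2M∣) 2M∣τ =
    rising x<M (subst (_ ∣_) (swap z (+ x) τ) (∣m∣n⇒∣m+n 2M∣ 2M∣τ))
    where
    swap : ∀ (z x τ : ℤ) → (z - x) + τ ≡ (z + τ) - x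
    swap = solve-∀
  folds-shift {z = z} {x = x} {τ = τ} (falling 0<x x≤M 2M∣) 2M∣τ =
    falling 0<x x≤M (subst (_ ∣_) (swap z (+ x) τ) (∣m∣n⇒∣m+n 2M∣ 2M∣τ))
    where
    swap : ∀ (z x τ : ℤ) → (z + x) + τ ≡ (z + τ) + x
    swap = solve-∀

  folds-reverses : 0 < x → x < M → Folds M A x e → Reverses M A τ → Folds M (A + τ) x (not e)
  folds-reverses {A = A} {τ = τ} 0<x x<M start rev =
    subst (λ z → Folds _ z _ _) (cancel A τ) (folds-shift (folds-neg 0<x x<M start) rev)
    where
    cancel : ∀ (A τ : ℤ) → - A + (A + A + τ) ≡ A + τ
    cancel = solve-∀

  folds-wall : Folds M (A + τ) x d → x ≡ 0 ⊎ x ≡ M → AtWall M A τ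
  folds-wall {A = A} {τ} (rising _ 2M∣) (inj₁ refl) = ∣-half (subst (_ ∣_) (ℤ.+-identityʳ (A + τ)) 2M∣)
  folds-wall (rising x<M _)       (inj₂ refl) = contradiction x<M (ℕ.<-irrefl refl)
  folds-wall (falling 0<x _ _)    (inj₁ refl) = contradiction 0<x (ℕ.<-irrefl refl)
  folds-wall (falling _ _ 2M∣)    (inj₂ refl) = ∣m+n∣n⇒∣m (∣-half 2M∣) ∣-refl

  folds-same-position : Folds M A x e → Folds M (A + τ) x d → Repeats M τ ⊎ Reverses M A τ
  folds-same-position {A = A} {x} {τ = τ} (rising _ 2M∣) (rising _ 2M∣′) =
    inj₁ (subst (_ ∣_) (cancel A (+ x) τ) (∣m∣n⇒∣m-n 2M∣′ 2M∣))
    where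
    cancel : ∀ (A x τ : ℤ) → (A + τ - x) - (A - x) ≡ τ
    cancel = solve-∀
  folds-same-position {A = A} {x} {τ = τ} (rising _ 2M∣) (falling _ _ 2M∣′) =
    inj₂ (subst (_ ∣_) (cancel A (+ x) τ) (∣m∣n⇒∣m+n 2M∣ 2M∣′))
    where
    cancel : ∀ (A x τ : ℤ) → (A - x) + (A + τ + x) ≡ A + A + τ
    cancel = solve-∀
  folds-same-position {A = A} {x} {τ = τ} (falling _ _ 2M∣) (rising _ 2M∣′) =
    inj₂ (subst (_ ∣_) (cancel A (+ x) τ) (∣m∣n⇒∣m+n 2M∣ 2M∣′))
    where
    cancel : ∀ (A x τ : ℤ) → (A + x) + (A + τ - x) ≡ A + A + τ
    cancel = solve-∀
  folds-same-position {A = A} {x} {τ = τ} (falling _ _ 2M∣) (falling _ _ 2M∣′) =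
    inj₁ (subst (_ ∣_) (cancel A (+ x) τ) (∣m∣n⇒∣m-n 2M∣′ 2M∣))
    where
    cancel : ∀ (A x τ : ℤ) → (A + τ + x) - (A + x) ≡ τ
    cancel = solve-∀

  repeats-sub : Repeats M p → Repeats M τ → Repeats M (τ - p)
  repeats-sub rep rep′ = ∣m∣n⇒∣m-n rep′ rep

  reverses-sub : Repeats M p → Reverses M A τ → Reverses M A (τ - p)
  reverses-sub {p = p} {A = A} {τ} rep rev = subst (_ ∣_) (ℤ.+-assoc (A + A) τ (- p)) (∣m∣n⇒∣m-n rev rep)

  repeats-reflect : Reverses M A p → Repeats M τ → Reverses M A (p - τ)
  repeats-reflect {A = A} {p} {τ} rev rep = subst (_ ∣_) (ℤ.+-assoc (A + A) p (- τ)) (∣m∣n⇒∣m-n rev rep)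

  reverses-reflect : Reverses M A p → Reverses M A τ → Repeats M (p - τ)
  reverses-reflect {A = A} {p} {τ} rev rev′ = subst (_ ∣_) (cancel A p τ) (∣m∣n⇒∣m-n rev rev′)
    where
    cancel : ∀ (A p τ : ℤ) → (A + A + p) - (A + A + τ) ≡ p - τ
    cancel = solve-∀

  atWall⇒reverses : AtWall M A τ → Reverses M A (τ + τ)
  atWall⇒reverses {M} {A} {τ} (divides q eq) = divides q (begin
    A + A + (τ + τ)     ≡⟨ regroup A τ ⟩
    (A + τ) + (A + τ)   ≡⟨ cong₂ _+_ eq eq ⟩
    q * + M + q * + M   ≡⟨ ℤ.*-distribˡ-+ q (+ M) (+ M) ⟨
    q * + (M ℕ.+ M)     ∎)
    where
    open ≡-Reasoning
    regroup : ∀ (A τ : ℤ) → A + A + (τ + τ) ≡ (A + τ) + (A + τ)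
    regroup = solve-∀

  repeats-double-multiple : ∀ i → Repeats M (i * + M + i * + M)
  repeats-double-multiple {M} i = divides i (sym (ℤ.*-distribˡ-+ i (+ M) (+ M)))

  repeats-neg : Repeats M τ → Repeats M (- τ)
  repeats-neg = ∣m⇒∣-m

  reverses-neg : Reverses M A τ → Reverses M (- A) (- τ)
  reverses-neg {A = A} {τ} rev = subst (_ ∣_) (negate A τ) (∣m⇒∣-m rev)
    where
    negate : ∀ (A τ : ℤ) → - (A + A + τ) ≡ - A + - A + - τ
    negate = solve-∀

  wall-from-gcd : gcd M N ∣ℕ x → ∃ λ i → AtWall M (+ x) (i * + N)
  wall-from-gcd {M} {N} {x} (dividesℕ w x≡wg) with bézout M N
  ... | u , v , uM+vN≡g = - (+ w * v) , divides (+ w * u) (begin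
    + x + - (+ w * v) * + N                           ≡⟨ cong (λ x → x + - (+ w * v) * + N) x≡wg′ ⟩
    + w * + gcd M N + - (+ w * v) * + N               ≡⟨ cong (λ g → + w * g + - (+ w * v) * + N) uM+vN≡g ⟨
    + w * (u * + M + v * + N) + - (+ w * v) * + N     ≡⟨ cancel (+ w) u v (+ M) (+ N) ⟩
    + w * u * + M                                     ∎)
    where
    open ≡-Reasoning
    x≡wg′ : + x ≡ + w * + gcd M N
    x≡wg′ = trans (cong +_ x≡wg) (ℤ.pos-* w (gcd M N))
    cancel : ∀ (w u v M N : ℤ) → w * (u * M + v * N) + - (w * v) * N ≡ w * u * M
    cancel = solve-∀

Corner : ℕ → ℕ → ℤ → ℤ → ℤ → Set
Corner M N A B τ = AtWall M A τ × AtWall N B τ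

Returns : ℕ → ℕ → ℤ → ℤ → ℤ → Set
Returns M N A B τ = (Repeats M τ ⊎ Reverses M A τ) × (Repeats N τ ⊎ Reverses N B τ)

Turns : ℕ → ℕ → ℤ → ℤ → ℤ → Set
Turns M N A B τ = (Reverses M A τ × Repeats N τ) ⊎ (Repeats M τ × Reverses N B τ)

Stops : ℕ → ℕ → ℤ → ℤ → ℤ → Set
Stops M N A B τ = Corner M N A B τ ⊎ Returns M N A B τ

turns? : ∀ M N A B τ → Dec (Turns M N A B τ)
turns? M N A B τ = (reverses? M A τ ×-dec repeats? N τ) ⊎-dec (repeats? M τ ×-dec reverses? N B τ)

turns-sub : Repeats M p → Repeats N p → Turns M N A B τ → Turns M N A B (τ - p)
turns-sub repM repN (inj₁ (rev , rep)) = inj₁ (reverses-sub repM rev , repeats-sub repN rep)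
turns-sub repM repN (inj₂ (rep , rev)) = inj₂ (repeats-sub repM rep , reverses-sub repN rev)

turns-reflect : Reverses M A p → Reverses N B p → Turns M N A B τ → Turns M N A B (p - τ)
turns-reflect revM revN (inj₁ (rev , rep)) = inj₂ (reverses-reflect revM rev , repeats-reflect revN rep)
turns-reflect revM revN (inj₂ (rep , rev)) = inj₁ (repeats-reflect revM rep , reverses-reflect revN rev)

turns-neg : Turns M N A B τ → Turns M N (- A) (- B) (- τ)
turns-neg (inj₁ (rev , rep)) = inj₁ (reverses-neg rev , repeats-neg rep)
turns-neg (inj₂ (rep , rev)) = inj₂ (repeats-neg rep , reverses-neg rev)

turns-from-gcd : gcd M N ∣ℕ a ⊎ gcd M N ∣ℕ b → ∃ λ τ → Turns M N (+ a) (+ b) τ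
turns-from-gcd (inj₁ g∣a) with wall-from-gcd g∣a
... | i , wall = _ , inj₁ (atWall⇒reverses wall , repeats-double-multiple i)
turns-from-gcd {M} {N} {b = b} (inj₂ g∣b) with wall-from-gcd (subst (_∣ℕ b) (gcd-comm M N) g∣b)
... | i , wall = _ , inj₂ (repeats-double-multiple i , atWall⇒reverses wall)

TurnFree : ℕ → ℕ → ℤ → ℤ → ℕ → Set
TurnFree M N A B t = ∀ τ → ∣ τ ∣ < t → ¬ Turns M N A B τ

StopFree : ℕ → ℕ → ℤ → ℤ → ℕ → Set
StopFree M N A B t = ∀ {k} → 0 < k → k < t → ¬ Stops M N A B (+ k)

nearest-turn-stop-free : Turns M N A B (+ t) → TurnFree M N A B t → StopFree M N A B t
nearest-turn-stop-free {t = suc _} turn free {k} 0<k k<t (inj₁ (wallM , wallN)) =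
  free _ (∣m-n∣<o (ℕ.+-mono-< k<t k<t) (ℕ.m<n+m _ (ℕ.<-≤-trans 0<k (ℕ.m≤m+n k k))))
    (turns-reflect (atWall⇒reverses wallM) (atWall⇒reverses wallN) turn)
nearest-turn-stop-free {t = suc _} turn free 0<k k<t (inj₂ (inj₁ repM , inj₁ repN)) =
  free _ (∣m-n∣<o (ℕ.m<n+m _ 0<k) (ℕ.<-≤-trans k<t (ℕ.m≤m+n _ _))) (turns-sub repM repN turn)
nearest-turn-stop-free {t = suc _} turn free 0<k k<t (inj₂ (inj₂ revM , inj₂ revN)) =
  free _ (∣m-n∣<o (ℕ.<-≤-trans k<t (ℕ.m≤m+n _ _)) (ℕ.m<n+m _ 0<k)) (turns-reflect revM revN turn)
nearest-turn-stop-free turn free {k} _ k<t (inj₂ (inj₁ repM , inj₂ revN)) = free (+ k) k<t (inj₂ (repM , revN))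
nearest-turn-stop-free turn free {k} _ k<t (inj₂ (inj₂ revM , inj₁ repN)) = free (+ k) k<t (inj₁ (revM , repN))

turns-at-±∣τ∣ : Turns M N A B τ → Turns M N A B (+ ∣ τ ∣) ⊎ Turns M N A B (- + ∣ τ ∣)
turns-at-±∣τ∣ {τ = + _}      = inj₁
turns-at-±∣τ∣ {τ = -[1+ _ ]} = inj₂

nearest-turn : Turns M N A B τ → ∃ λ t → (Turns M N A B (+ t) ⊎ Turns M N A B (- + t)) × TurnFree M N A B t
nearest-turn {M} {N} {A} {B} turn
  with minimal-witness (λ j → turns? M N A B (+ j) ⊎-dec turns? M N A B (- + j)) (turns-at-±∣τ∣ turn)
... | t , turn-t , nearer-free = t , turn-t , free
  where
  free : TurnFree M N A B t
  free (+ _)    j<t turn-j = nearer-free j<t (inj₁ turn-j)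
  free -[1+ _ ] j<t turn-j = nearer-free j<t (inj₂ turn-j)

turn-free-neg : TurnFree M N A B t → TurnFree M N (- A) (- B) t
turn-free-neg {M} {N} {A} {B} free τ ∣τ∣<t turn =
  free (- τ) (subst (_< _) (sym (ℤ.∣-i∣≡∣i∣ τ)) ∣τ∣<t)
    (subst₂ (λ A B → Turns M N A B (- τ)) (ℤ.neg-involutive A) (ℤ.neg-involutive B) (turns-neg turn))

-- The ray in direction (-, -) is the unfolded line run backwards, i.e. from -A.
orient : Bool → ℤ → ℤ
orient true  A = A
orient false A = - A

first-turn : Turns M N A B τ →
  ∃₂ λ e t → Turns M N (orient e A) (orient e B) (+ t) × StopFree M N (orient e A) (orient e B) t
first-turn turn with nearest-turn turn
... | t , inj₁ turn-t , free = true , t , turn-t , nearest-turn-stop-free turn-t free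
... | t , inj₂ turn-t , free = false , t , turn-t′ , nearest-turn-stop-free turn-t′ (turn-free-neg free)
  where
  turn-t′ : Turns _ _ (- _) (- _) (+ t)
  turn-t′ = subst (Turns _ _ _ _) (ℤ.neg-involutive (+ t)) (turns-neg turn-t)

folds-start : 0 < a → a < M → ∀ e → Folds M (orient e (+ a)) a e
folds-start {a} {M} 0<a a<M true  =
  rising a<M (divides 0ℤ (trans (ℤ.+-inverseʳ (+ a)) (sym (ℤ.*-zeroˡ (+ (M ℕ.+ M))))))
folds-start 0<a a<M false = folds-neg 0<a a<M (folds-start 0<a a<M true)

+-pos-suc : ∀ z t → z + + t + 1ℤ ≡ z + + suc t
+-pos-suc z t = trans (ℤ.+-assoc z (+ t) 1ℤ) (cong (λ t → z + + t) (ℕ.+-comm t 1))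

ray-folds-x : ∀ {s} → Folds (suc m) z (px s) (dx s) →
  ∀ t → Folds (suc m) (z + + t) (px (rayAt m n s t)) (dx (rayAt m n s t))
ray-folds-x {z = z} start zero    = subst (λ z → Folds _ z _ _) (sym (ℤ.+-identityʳ z)) start
ray-folds-x {z = z} start (suc t) = subst (λ z → Folds _ z _ _) (+-pos-suc z t) (folds-suc (ray-folds-x start t))

ray-folds-y : ∀ {s} → Folds (suc n) z (py s) (dy s) →
  ∀ t → Folds (suc n) (z + + t) (py (rayAt m n s t)) (dy (rayAt m n s t))
ray-folds-y {z = z} start zero    = subst (λ z → Folds _ z _ _) (sym (ℤ.+-identityʳ z)) start
ray-folds-y {z = z} start (suc t) = subst (λ z → Folds _ z _ _) (+-pos-suc z t) (folds-suc (ray-folds-y start t))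

OneReversed : Bool → Bool → Bool → Set
OneReversed e fx fy = fx ≡ not e × fy ≡ e ⊎ fx ≡ e × fy ≡ not e

perp-one-reversed : ∀ {fx fy} → OneReversed e fx fy → Perp e e fx fy
perp-one-reversed (inj₁ (refl , refl)) = inj₂ (not-¬ refl , refl)
perp-one-reversed (inj₂ (refl , refl)) = inj₁ (refl , not-¬ refl)

ray-closed-90 : 0 < a → a < suc m → 0 < b → b < suc n →
  Folds (suc m) A a e → Folds (suc n) B b e →
  Turns (suc m) (suc n) A B (+ t) → StopFree (suc m) (suc n) A B t → RayClosed90Trail m n a b e e
ray-closed-90 {a} {m} {b} {n} {A} {e} {B} {t} 0<a a<M 0<b b<N startX startY turn stop-free =
  t , (positive (proj₂ arrival) , proj₁ arrival , no-stop) , perp-one-reversed (proj₂ arrival)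
  where
  ray : ℕ → RayState
  ray = rayAt m n (st a b e e)

  X : ∀ k → Folds (suc m) (A + + k) (px (ray k)) (dx (ray k))
  X = ray-folds-x startX

  Y : ∀ k → Folds (suc n) (B + + k) (py (ray k)) (dy (ray k))
  Y = ray-folds-y startY

  arrival-at : Turns (suc m) (suc n) A B (+ t) →
    (px (ray t) ≡ a × py (ray t) ≡ b) × OneReversed e (dx (ray t)) (dy (ray t))
  arrival-at (inj₁ (revM , repN)) =
    let x≡a , dx≡¬e = folds-functional (X t) (folds-reverses 0<a a<M startX revM)
        y≡b , dy≡e  = folds-functional (Y t) (folds-shift startY repN)
    in (x≡a , y≡b) , inj₁ (dx≡¬e , dy≡e)
  arrival-at (inj₂ (repM , revN)) =
    let x≡a , dx≡e  = folds-functional (X t) (folds-shift startX repM)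
        y≡b , dy≡¬e = folds-functional (Y t) (folds-reverses 0<b b<N startY revN)
    in (x≡a , y≡b) , inj₂ (dx≡e , dy≡¬e)

  arrival : (px (ray t) ≡ a × py (ray t) ≡ b) × OneReversed e (dx (ray t)) (dy (ray t))
  arrival = arrival-at turn

  positive : ∀ {k} → OneReversed e (dx (ray k)) (dy (ray k)) → 1 ≤ k
  positive {zero}  (inj₁ (e≡¬e , _)) = contradiction e≡¬e (not-¬ refl)
  positive {zero}  (inj₂ (_ , e≡¬e)) = contradiction e≡¬e (not-¬ refl)
  positive {suc _} _                 = s≤s z≤n

  no-stop : ∀ k → 1 ≤ k → k < t →
    ¬ IsCorner m n (px (ray k)) (py (ray k)) × ¬ (px (ray k) ≡ a × py (ray k) ≡ b)
  no-stop k 1≤k k<t =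
    (λ (wallX , wallY) → stop-free 1≤k k<t (inj₁ (folds-wall (X k) wallX , folds-wall (Y k) wallY))) ,
    (λ (x≡a , y≡b) → stop-free 1≤k k<t (inj₂
      ( folds-same-position startX (subst (λ x → Folds _ _ x (dx (ray k))) x≡a (X k))
      , folds-same-position startY (subst (λ y → Folds _ _ y (dy (ray k))) y≡b (Y k)))))

-- The hypotheses 1 ≤ m and 1 ≤ n are implied by IsVertex.
lemma2p1 : (m n a b : ℕ) → 1 ≤ m → 1 ≤ n → IsVertex m n a b →
    (gcd (m ℕ.+ 1) (n ℕ.+ 1) ∣ℕ a ⊎ gcd (m ℕ.+ 1) (n ℕ.+ 1) ∣ℕ b) →
    Σ Bool λ s → RayClosed90Trail m n a b s s
lemma2p1 m n a b _ _ ((0<a , a≤m) , (0<b , b≤n)) gcd∣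
  with first-turn (proj₂ (turns-from-gcd (subst₂ (λ M N → gcd M N ∣ℕ a ⊎ gcd M N ∣ℕ b)
                                                  (ℕ.+-comm m 1) (ℕ.+-comm n 1) gcd∣)))
... | e , _ , turn , stop-free =
  e , ray-closed-90 0<a (s≤s a≤m) 0<b (s≤s b≤n)
        (folds-start 0<a (s≤s a≤m) e) (folds-start 0<b (s≤s b≤n) e) turn stop-free
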